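{- $PC(T(3))=3$, where $T(3)$ is the perfect binary tree of height $3$.
   Context: The perfect binary tree $T(h)$ of height $h$ is the rooted tree in which every non-leaf vertex has exactly two children and every leaf is at distance exactly $h$ from the root (so $T(3)$ has 15 vertices). A paired dominating set of $G$ is a dominating set $S$ such that $G[S]$ has a perfect matching. Two disjoint sets form a paired coalition if neither is a paired dominating set but their union is. A $pc$-partition of $G$ is a partition of $V(G)$ into nonempty sets, none a paired dominating set, each forming a paired coalition with some other set of the partition. $PC(G)$ is the maximum number of sets in a $pc$-partition ($0$ if none exists). -}

module Defs where

open import Data.Nat using (ℕ; suc; _+_; _*_; _∸_; _^_; _≤_)
open import Data.Fin using (Fin; toℕ)
open import Data.Product using (Σ; ∃; _×_; _,_)
open import Data.Sum using (_⊎_)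
open import Relation.Binary.PropositionalEquality using (_≡_; _≢_)
open import Relation.Nullary using (¬_)
open import Data.Empty using (⊥)

record Graph : Set₁ where
  field
    n   : ℕ
    Adj : Fin n → Fin n → Set

open Graph public

-- Perfect binary tree T(h) in heap numbering: vertices 0 .. 2^(h+1)-2,
-- root 0, children of i are 2i+1 and 2i+2.
ChildOf : ℕ → ℕ → Set
ChildOf i j = (j ≡ 2 * i + 1) ⊎ (j ≡ 2 * i + 2)

T : ℕ → Graph
T h = record
  { n   = 2 ^ suc h ∸ 1
  ; Adj = λ u v → ChildOf (toℕ u) (toℕ v) ⊎ ChildOf (toℕ v) (toℕ u)
  }

VSet : Graph → Set₁
VSet G = Fin (n G) → Set

Dominating : (G : Graph) → VSet G → Set
Dominating G S = ∀ v → S v ⊎ ∃ λ u → Adj G v u × S u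

-- G[S] has a perfect matching: a partner function on S, pairing each
-- vertex of S with an adjacent vertex of S, that is an involution on S.
HasPerfectMatching : (G : Graph) → VSet G → Set
HasPerfectMatching G S =
  Σ (Fin (n G) → Fin (n G)) λ m →
    ∀ v → S v → S (m v) × Adj G v (m v) × m (m v) ≡ v

PairedDominating : (G : Graph) → VSet G → Set
PairedDominating G S = Dominating G S × HasPerfectMatching G S

Union : {G : Graph} → VSet G → VSet G → VSet G
Union A B v = A v ⊎ B v

Disjoint : {G : Graph} → VSet G → VSet G → Set
Disjoint A B = ∀ v → A v → B v → ⊥

PairedCoalition : (G : Graph) → VSet G → VSet G → Set
PairedCoalition G A B =
  Disjoint {G} A B × ¬ PairedDominating G A × ¬ PairedDominating G B
  × PairedDominating G (Union {G} A B)

-- A partition of V(G) into k nonempty sets, given by the class map.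
Class : (G : Graph) {k : ℕ} → (Fin (n G) → Fin k) → Fin k → VSet G
Class G col c v = col v ≡ c

IsPCPartition : (G : Graph) (k : ℕ) → (Fin (n G) → Fin k) → Set
IsPCPartition G k col =
  (∀ c → ∃ λ v → col v ≡ c)
  × (∀ c → ¬ PairedDominating G (Class G col c))
  × (∀ c → ∃ λ d → d ≢ c × PairedCoalition G (Class G col c) (Class G col d))

HasPCPartition : Graph → ℕ → Set
HasPCPartition G k = Σ (Fin (n G) → Fin k) (IsPCPartition G k)

-- PC(G) = p : p is the maximum size of a pc-partition, or 0 if none exists.
PCNumber : Graph → ℕ → Set
PCNumber G p =
  ((∀ k → ¬ HasPCPartition G k) × p ≡ 0)
  ⊎ (HasPCPartition G p × (∀ k → HasPCPartition G k → k ≤ p))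

-- Every paired dominating set contains the support vertices, and a leaf in it is
-- matched to its support. So in a pc-partition with at least four classes all supports
-- lie in one class P, and every other class c forms a coalition S c = c ∪ P. Within S c
-- a support (with its two leaves: a cherry) is matched either to its parent or to its
-- leaf of class c; consequently no leaf is in P and sibling leaves lie in different
-- classes. Call c full on a branch (a child of the root with its two cherries) when c
-- occurs on both cherries, i.e. when the top of the branch is not matched down in S c.
-- At most one class is full on a branch; hence the children of the root are in P, and
-- whether the root is in P or not, some branch would need more distinct leaf classes
-- than its four leaves carry. The lower bound is an explicit partition into three classes.
module Submission where

open import Defs
open import Data.Bool using (Bool; true; false; not; if_then_else_)
open import Data.Bool.Properties using (not-¬)
open import Data.Nat using (ℕ; _<_; _≤_; _≤?_)
import Data.Nat as ℕ
open import Data.Nat.Properties using (≰⇒>; ≤-trans; n≤1+n)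
open import Data.Fin using (Fin; toℕ; #_; zero; suc)
open import Data.Fin.Properties using (_≟_; any?; all?; pigeonhole; <⇒≢)
open import Data.Vec using (Vec; []; _∷_; lookup)
open import Data.Vec.Relation.Unary.Any using (here; there; index) renaming (any? to any-in?)
open import Data.Vec.Relation.Unary.Any.Properties using (lookup-index)
open import Data.Vec.Membership.Propositional using (_∈_; _∉_)
open import Data.Product using (∃; _×_; _,_; proj₁; proj₂)
open import Data.Sum using (_⊎_; inj₁; inj₂; map₂)
open import Data.Empty using (⊥; ⊥-elim)
open import Relation.Binary.PropositionalEquality using (_≡_; _≢_; refl; sym; trans; cong; subst; ≢-sym)
open import Relation.Nullary using (¬_; Dec; yes; no; ¬?; contradiction)
open import Relation.Nullary.Decidable using (True; toWitness; from-yes; decidable-stable; _⊎-dec_; _×-dec_; _→-dec_)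
open import Relation.Unary using (Decidable)

¬all-listed : ∀ {m n} → m < n → (xs : Vec (Fin n) m) → ¬ (∀ e → e ∈ xs)
¬all-listed m<n xs listed with pigeonhole m<n (λ e → index (listed e))
... | i , j , i<j , same-index = <⇒≢ i<j
  (trans (lookup-index (listed i)) (trans (cong (lookup xs) same-index) (sym (lookup-index (listed j)))))

∃-∉ : ∀ {m n} → m < n → (xs : Vec (Fin n) m) → ∃ λ e → e ∉ xs
∃-∉ m<n xs with any? (λ e → ¬? (any-in? (e ≟_) xs))
... | yes found = found
... | no none   = ⊥-elim (¬all-listed m<n xs λ e →
  decidable-stable (any-in? (e ≟_) xs) (λ e∉xs → none (e , e∉xs)))

two-of-three-equal : (a b c : Bool) → a ≡ b ⊎ a ≡ c ⊎ b ≡ c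
two-of-three-equal true  true  _     = inj₁ refl
two-of-three-equal false false _     = inj₁ refl
two-of-three-equal true  false true  = inj₂ (inj₁ refl)
two-of-three-equal true  false false = inj₂ (inj₂ refl)
two-of-three-equal false true  true  = inj₂ (inj₂ refl)
two-of-three-equal false true  false = inj₂ (inj₁ refl)

bool-cases : ∀ {P : Bool → Set} i → P i → P (not i) → ∀ j → P j
bool-cases true  pi _   true  = pi
bool-cases true  _  pni false = pni
bool-cases false _  pni true  = pni
bool-cases false pi _   false = pi

¬three-distinct-values : ∀ {A : Set} (f : Bool → A) {a b c} → a ≢ b → a ≢ c → b ≢ c →
                         (∃ λ i → f i ≡ a) → (∃ λ j → f j ≡ b) → (∃ λ l → f l ≡ c) → ⊥
¬three-distinct-values f a≢b a≢c b≢c (i , fi≡a) (j , fj≡b) (l , fl≡c) with two-of-three-equal i j l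
... | inj₁ refl        = a≢b (trans (sym fi≡a) fj≡b)
... | inj₂ (inj₁ refl) = a≢c (trans (sym fi≡a) fl≡c)
... | inj₂ (inj₂ refl) = b≢c (trans (sym fj≡b) fl≡c)

bool-injective : ∀ {A : Set} {f : Bool → A} → f true ≢ f false → ∀ {b b′} → f b ≡ f b′ → b ≡ b′
bool-injective _   {true}  {true}  _  = refl
bool-injective t≢f {true}  {false} eq = contradiction eq t≢f
bool-injective t≢f {false} {true}  eq = contradiction (sym eq) t≢f
bool-injective _   {false} {false} _  = refl

∃-bool : ∀ {A : Set} {f : Bool → A} {w} → w ≡ f true ⊎ w ≡ f false → ∃ λ b → w ≡ f b
∃-bool (inj₁ eq) = true , eq
∃-bool (inj₂ eq) = false , eq

-- Paired domination in an arbitrary graph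

Pendant : (G : Graph) → Fin (n G) → Fin (n G) → Set
Pendant G l s = ∀ w → Adj G l w → w ≡ s

Forced : (G : Graph) → Fin (n G) → Set₁
Forced G v = ∀ S → PairedDominating G S → S v

IsPairing : (G : Graph) → VSet G → (Fin (n G) → Fin (n G)) → Set
IsPairing G S m = ∀ v → S v → S (m v) × Adj G v (m v) × m (m v) ≡ v

module Pairing {G : Graph} {S : VSet G} {m : Fin (n G) → Fin (n G)} (pairing : IsPairing G S m) where

  partner-∈ : ∀ {v} → S v → S (m v)
  partner-∈ {v} v∈S = proj₁ (pairing v v∈S)

  partner-adj : ∀ {v} → S v → Adj G v (m v)
  partner-adj {v} v∈S = proj₁ (proj₂ (pairing v v∈S))

  partner-involutive : ∀ {v} → S v → m (m v) ≡ v
  partner-involutive {v} v∈S = proj₂ (proj₂ (pairing v v∈S))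

  partner-injective : ∀ {u v} → S u → S v → m u ≡ m v → u ≡ v
  partner-injective u∈S v∈S eq =
    trans (sym (partner-involutive u∈S)) (trans (cong m eq) (partner-involutive v∈S))

  partner-sym : ∀ {u v} → S u → m u ≡ v → m v ≡ u
  partner-sym u∈S refl = partner-involutive u∈S

  pendant-partner : ∀ {l s} → Pendant G l s → S l → m l ≡ s
  pendant-partner pendant l∈S = pendant _ (partner-adj l∈S)

support-forced : ∀ {G l s} → Pendant G l s → Forced G s
support-forced {G} {l} pendant S (dom , m , pairing) with dom l
... | inj₁ l∈S = subst S (pendant-partner pendant l∈S) (partner-∈ l∈S)
  where open Pairing {G} pairing
... | inj₂ (u , l~u , u∈S) = subst S (pendant u l~u) u∈S

record Cherry (G : Graph) (parent : Fin (n G)) : Set where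
  field
    support        : Fin (n G)
    leaf           : Bool → Fin (n G)
    leaf-pendant   : ∀ b → Pendant G (leaf b) support
    support-nbrs   : ∀ w → Adj G support w → w ≡ parent ⊎ ∃ λ b → w ≡ leaf b
    leaf-injective : ∀ {b b′} → leaf b ≡ leaf b′ → b ≡ b′
    leaf≢parent    : ∀ b → leaf b ≢ parent

  LeafIn : VSet G → Set
  LeafIn S = ∃ λ b → S (leaf b)

  module _ {S : VSet G} {m : Fin (n G) → Fin (n G)} (pairing : IsPairing G S m) where
    open Pairing {G} pairing

    leaf-∈-unique : ∀ {b b′} → S (leaf b) → S (leaf b′) → b ≡ b′
    leaf-∈-unique l∈S l′∈S = leaf-injective
      (partner-injective l∈S l′∈S
        (trans (pendant-partner (leaf-pendant _) l∈S) (sym (pendant-partner (leaf-pendant _) l′∈S))))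

    leaf-in⇒matched-down : LeafIn S → m support ≢ parent
    leaf-in⇒matched-down (b , l∈S) eq =
      leaf≢parent b (trans (sym (partner-sym l∈S (pendant-partner (leaf-pendant b) l∈S))) eq)

    matched-down⇒leaf-in : S support → m support ≢ parent → LeafIn S
    matched-down⇒leaf-in s∈S down with support-nbrs _ (partner-adj s∈S)
    ... | inj₁ up           = contradiction up down
    ... | inj₂ (b , m≡leaf) = b , subst S m≡leaf (partner-∈ s∈S)

record Branch (G : Graph) (root : Fin (n G)) : Set where
  field
    top                 : Fin (n G)
    cherry              : Bool → Cherry G top
  open module C b = Cherry (cherry b) public using (support; LeafIn)
  field
    top-nbrs            : ∀ w → Adj G top w → w ≡ root ⊎ ∃ λ b → w ≡ support b
    support-injective   : ∀ {b b′} → support b ≡ support b′ → b ≡ b′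
    support≢root        : ∀ b → support b ≢ root

  Full : VSet G → Set
  Full S = ∀ b → LeafIn b S

  module _ {S : VSet G} {m : Fin (n G) → Fin (n G)} (pairing : IsPairing G S m)
           (supports∈S : ∀ b → S (support b)) where
    open Pairing {G} pairing

    some-leaf-in : ∃ λ b → LeafIn b S
    some-leaf-in with m (support true) ≟ top
    ... | no down = true , C.matched-down⇒leaf-in true pairing (supports∈S true) down
    ... | yes up  = false , C.matched-down⇒leaf-in false pairing (supports∈S false) λ up′ →
      contradiction (support-injective (partner-injective (supports∈S true) (supports∈S false) (trans up (sym up′))))
                    λ ()

    full-unless-matched-down : (S top → m top ≡ root) → Full S
    full-unless-matched-down up b = C.matched-down⇒leaf-in b pairing (supports∈S b) λ s↦top →
      support≢root b (trans (sym (partner-sym (supports∈S b) s↦top))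
                            (up (subst S s↦top (partner-∈ (supports∈S b)))))

  not-full-if-matched-down : ∀ {S m} (pairing : IsPairing G S m) → S top → m top ≢ root → ¬ Full S
  not-full-if-matched-down pairing t∈S down full with top-nbrs _ (Pairing.partner-adj {G} pairing t∈S)
  ... | inj₁ up           = down up
  ... | inj₂ (b , t↦s)    =
    C.leaf-in⇒matched-down b pairing (full b) (Pairing.partner-sym {G} pairing t∈S t↦s)

record Tree₃ (G : Graph) : Set where
  field
    root           : Fin (n G)
    branch         : Bool → Branch G root
  open module B β = Branch (branch β) using (top)
  field
    root-nbrs      : ∀ w → Adj G root w → ∃ λ β → w ≡ top β
    top-injective  : ∀ {β β′} → top β ≡ top β′ → β ≡ β′

  supports-forced : ∀ β b → Forced G (B.support β b)
  supports-forced β b = support-forced (Cherry.leaf-pendant (Branch.cherry (branch β) b) true)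

module PCPartition {G : Graph} {k : ℕ} {col : Fin (n G) → Fin k} (part : IsPCPartition G k col) where

  cls : Fin k → VSet G
  cls = Class G col

  partner : Fin k → Fin k
  partner c = proj₁ (proj₂ (proj₂ part) c)

  coalition-pd : ∀ c → PairedDominating G (Union {G} (cls c) (cls (partner c)))
  coalition-pd c = let (_ , _ , _ , _ , _ , pd) = proj₂ (proj₂ part) c in pd

  forced-in-coalition : ∀ {v} → Forced G v → ∀ c → col v ≡ c ⊎ col v ≡ partner c
  forced-in-coalition forced c = forced _ (coalition-pd c)

  forced-classes-coincide : 2 < k → ∀ {u v} → Forced G u → Forced G v → col u ≡ col v
  forced-classes-coincide 2<k {u} fu fv = trans (in-partner-of-e fu) (sym (in-partner-of-e fv))
    where
    c = col u
    fresh = ∃-∉ 2<k (c ∷ partner c ∷ [])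
    e = proj₁ fresh
    in-partner-of-e : ∀ {w} → Forced G w → col w ≡ partner e
    in-partner-of-e fw with forced-in-coalition fw e | forced-in-coalition fw c
    ... | inj₂ w∈partner | _         = w∈partner
    ... | inj₁ w∈e       | inj₁ w∈c  = contradiction (here (trans (sym w∈e) w∈c)) (proj₂ fresh)
    ... | inj₁ w∈e       | inj₂ w∈pc = contradiction (there (here (trans (sym w∈e) w∈pc))) (proj₂ fresh)

  pairs-with-forced-class : ∀ {u} → Forced G u → ∀ {c} → c ≢ col u →
                            PairedDominating G (Union {G} (cls c) (cls (col u)))
  pairs-with-forced-class fu {c} c≢u with forced-in-coalition fu c
  ... | inj₁ u∈c       = contradiction (sym u∈c) c≢u
  ... | inj₂ u∈partner =
    subst (λ d → PairedDominating G (Union {G} (cls c) (cls d))) (sym u∈partner) (coalition-pd c)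

-- At most three classes

module NoLargePCPartition {G : Graph} (𝒯 : Tree₃ G) {k : ℕ} {col : Fin (n G) → Fin k}
                          (part : IsPCPartition G k col) (3<k : 3 < k) where
  open Tree₃ 𝒯
  open PCPartition part
  open B using (top; cherry)
  open module C β b = Cherry (cherry β b) using (support)

  Colour : Set
  Colour = Fin k

  fresh : (x y z : Colour) → ∃ λ e → e ≢ x × e ≢ y × e ≢ z
  fresh x y z with ∃-∉ 3<k (x ∷ y ∷ z ∷ [])
  ... | e , e∉ = e , (λ eq → e∉ (here eq)) , (λ eq → e∉ (there (here eq))) , (λ eq → e∉ (there (there (here eq))))

  P : Colour
  P = col (support true true)

  supports-P : ∀ β b → col (support β b) ≡ P
  supports-P β b = forced-classes-coincide (≤-trans (n≤1+n 3) 3<k) (supports-forced β b) (supports-forced true true)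

  S : Colour → VSet G
  S c = Union {G} (cls c) (cls P)

  partner-map : ∀ c → c ≢ P → Fin (n G) → Fin (n G)
  partner-map c c≢P = proj₁ (proj₂ (pairs-with-forced-class (supports-forced true true) c≢P))

  pairing : ∀ c (c≢P : c ≢ P) → IsPairing G (S c) (partner-map c c≢P)
  pairing c c≢P = proj₂ (proj₂ (pairs-with-forced-class (supports-forced true true) c≢P))

  Occurs : Colour → Bool → Bool → Set
  Occurs c β b = Cherry.LeafIn (cherry β b) (cls c)

  Full : Colour → Bool → Set
  Full c β = ∀ b → Occurs c β b

  module _ {x : Fin (n G)} (κ : Cherry G x) where
    open Cherry κ

    leaf-colour≢P : ∀ b → col (leaf b) ≢ P
    leaf-colour≢P b l∈P with col (leaf (not b)) ≟ P | fresh P P P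
    ... | yes l′∈P | c , c≢P , _ = not-¬ refl (leaf-∈-unique (pairing c c≢P) (inj₂ l∈P) (inj₂ l′∈P))
    ... | no l′∉P  | _           = not-¬ refl (leaf-∈-unique (pairing _ l′∉P) (inj₂ l∈P) (inj₁ refl))

    leaf-colour-injective : ∀ {b b′} → col (leaf b) ≡ col (leaf b′) → b ≡ b′
    leaf-colour-injective {b} same = leaf-∈-unique (pairing _ (leaf-colour≢P b)) (inj₁ refl) (inj₁ (sym same))

    leaf-in⇒occurs : ∀ {c} → LeafIn (S c) → LeafIn (cls c)
    leaf-in⇒occurs (b , inj₁ l∈c) = b , l∈c
    leaf-in⇒occurs (b , inj₂ l∈P) = contradiction l∈P (leaf-colour≢P b)

  supports∈S : ∀ c β b → S c (support β b)
  supports∈S c β b = inj₂ (supports-P β b)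

  full⇒leaves-in : ∀ {c β} → Full c β → Branch.Full (branch β) (S c)
  full⇒leaves-in full b = proj₁ (full b) , inj₁ (proj₂ (full b))

  occurs-on-branch : ∀ {c} → c ≢ P → ∀ β → ∃ λ b → Occurs c β b
  occurs-on-branch c≢P β with B.some-leaf-in β (pairing _ c≢P) (supports∈S _ β)
  ... | b , leaf-in = b , leaf-in⇒occurs (cherry β b) leaf-in

  full-colour-unique : ∀ {a b} β → a ≢ P → b ≢ P → Full a β → Full b β → a ≡ b
  full-colour-unique {a} {b} β a≢P b≢P full-a full-b with a ≟ b | fresh P a b
  ... | yes a≡b | _                   = a≡b
  ... | no a≢b  | c , c≢P , c≢a , c≢b with occurs-on-branch c≢P β
  ...   | i , c-on-i = ⊥-elim (¬three-distinct-values (λ j → col (Cherry.leaf (cherry β i) j))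
                                 a≢b (≢-sym c≢a) (≢-sym c≢b) (full-a i) (full-b i) c-on-i)

  top-absent⇒full : ∀ {c} → c ≢ P → ∀ β → ¬ S c (top β) → Full c β
  top-absent⇒full c≢P β t∉S b = leaf-in⇒occurs (cherry β b)
    (B.full-unless-matched-down β (pairing _ c≢P) (supports∈S _ β) (λ t∈S → contradiction t∈S t∉S) b)

  top-colour≡P : ∀ β → col (top β) ≡ P
  top-colour≡P β with col (top β) ≟ P
  ... | yes t∈P = t∈P
  ... | no t∉P with fresh P (col (top β)) (col (top β))
  ...   | e₁ , e₁≢P , e₁≢t , _ with fresh P (col (top β)) e₁
  ...     | e₂ , e₂≢P , e₂≢t , e₂≢e₁ =
    contradiction (full-colour-unique β e₂≢P e₁≢P (full e₂≢P e₂≢t) (full e₁≢P e₁≢t)) e₂≢e₁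
    where
    full : ∀ {e} → e ≢ P → e ≢ col (top β) → Full e β
    full e≢P e≢t = top-absent⇒full e≢P β λ { (inj₁ t∈e) → e≢t (sym t∈e) ; (inj₂ t∈P) → t∉P t∈P }

  tops∈S : ∀ c β → S c (top β)
  tops∈S c β = inj₂ (top-colour≡P β)

  root-matched⇒one-full : ∀ {c} → c ≢ P → S c root → ∃ λ β → Full c β × ¬ Full c (not β)
  root-matched⇒one-full {c} c≢P r∈S with root-nbrs _ (Pairing.partner-adj {G} (pairing c c≢P) r∈S)
  ... | β , r↦t = β , full , not-full
    where
    open Pairing {G} (pairing c c≢P)
    t↦r = partner-sym r∈S r↦t
    full : Full c β
    full b = leaf-in⇒occurs (cherry β b)
      (B.full-unless-matched-down β (pairing c c≢P) (supports∈S c β) (λ _ → t↦r) b)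
    not-full : ¬ Full c (not β)
    not-full full′ = B.not-full-if-matched-down (not β) (pairing c c≢P) (tops∈S c (not β))
      (λ t′↦r → not-¬ refl (top-injective
        (partner-injective (tops∈S c β) (tops∈S c (not β)) (trans t↦r (sym t′↦r)))))
      (full⇒leaves-in full′)

  root-absent⇒not-full : ∀ {c} → c ≢ P → ¬ S c root → ∀ β → ¬ Full c β
  root-absent⇒not-full {c} c≢P r∉S β full = B.not-full-if-matched-down β (pairing c c≢P) (tops∈S c β)
    (λ t↦r → r∉S (subst (S c) t↦r (partner-∈ (tops∈S c β))))
    (full⇒leaves-in full)
    where open Pairing {G} (pairing c c≢P)

  root-colour≢P : col root ≢ P
  root-colour≢P r∈P with fresh P P P
  ... | c₁ , c₁≢P , _ with fresh P c₁ c₁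
  ...   | c₂ , c₂≢P , c₂≢c₁ , _ with fresh P c₁ c₂
  ...     | c₃ , c₃≢P , c₃≢c₁ , c₃≢c₂
    with root-matched⇒one-full c₁≢P (inj₂ r∈P) | root-matched⇒one-full c₂≢P (inj₂ r∈P)
       | root-matched⇒one-full c₃≢P (inj₂ r∈P)
  ... | β₁ , full₁ , _ | β₂ , full₂ , _ | β₃ , full₃ , _ with two-of-three-equal β₁ β₂ β₃
  ... | inj₁ refl        = c₂≢c₁ (full-colour-unique β₁ c₂≢P c₁≢P full₂ full₁)
  ... | inj₂ (inj₁ refl) = c₃≢c₁ (full-colour-unique β₁ c₃≢P c₁≢P full₃ full₁)
  ... | inj₂ (inj₂ refl) = c₃≢c₂ (full-colour-unique β₂ c₃≢P c₂≢P full₃ full₂)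

  only-root-colour-can-be-full : ∀ β → ¬ Full (col root) β → ∀ c → c ≢ P → ¬ Full c β
  only-root-colour-can-be-full β not-full c c≢P with c ≟ col root
  ... | yes refl = not-full
  ... | no c≢r   = root-absent⇒not-full c≢P (λ { (inj₁ r∈c) → c≢r (sym r∈c) ; (inj₂ r∈P) → root-colour≢P r∈P }) β

  -- On β the class C takes one leaf of each cherry, so every class other than P is C or
  -- one of the two remaining leaf classes Y b. On β′ the sibling of a leaf of class C and
  -- the two leaves of the other cherry carry three further pairwise distinct classes.
  full-branch-forces-full-colour : ∀ {C β} → C ≢ P → Full C β → ∀ β′ → ¬ (∀ c → c ≢ P → ¬ Full c β′)
  full-branch-forces-full-colour {C} {β} C≢P full β′ none-full with occurs-on-branch C≢P β′
  ... | i , j , C-at = ¬three-distinct-values Y a≢b₁ a≢b₂ b₁≢b₂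
                         (covered (leaf-colour≢P (cherry β′ i) (not j)) a≢C)
                         (covered (leaf-colour≢P (cherry β′ (not i)) true) (b≢C true))
                         (covered (leaf-colour≢P (cherry β′ (not i)) false) (b≢C false))
    where
    leaf′ : Bool → Bool → Fin (n G)
    leaf′ = C.leaf β′
    Y : Bool → Colour
    Y b = col (C.leaf β b (not (proj₁ (full b))))
    covered : ∀ {c} → c ≢ P → c ≢ C → ∃ λ b → Y b ≡ c
    covered {c} c≢P c≢C with occurs-on-branch c≢P β
    ... | b , l , l∈c = bool-cases {P = λ l → col (C.leaf β b l) ≡ c → ∃ λ b → Y b ≡ c} (proj₁ (full b))
                          (λ l∈c → contradiction (trans (sym l∈c) (proj₂ (full b))) c≢C) (λ l∈c → b , l∈c) l l∈c
    spread : ∀ {c} → c ≢ P → Occurs c β′ i → Occurs c β′ (not i) → ⊥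
    spread c≢P on-i on-not-i = none-full _ c≢P (bool-cases i on-i on-not-i)
    a = col (leaf′ i (not j))
    b₁ = col (leaf′ (not i) true)
    b₂ = col (leaf′ (not i) false)
    a≢C : a ≢ C
    a≢C a≡C = not-¬ refl (sym (leaf-colour-injective (cherry β′ i) (trans a≡C (sym C-at))))
    b≢C : ∀ t → col (leaf′ (not i) t) ≢ C
    b≢C t b≡C = spread C≢P (j , C-at) (t , b≡C)
    a≢b : ∀ t → a ≢ col (leaf′ (not i) t)
    a≢b t a≡b = spread (leaf-colour≢P (cherry β′ i) (not j)) (not j , refl) (t , sym a≡b)
    a≢b₁ = a≢b true
    a≢b₂ = a≢b false
    b₁≢b₂ : b₁ ≢ b₂
    b₁≢b₂ b₁≡b₂ with leaf-colour-injective (cherry β′ (not i)) b₁≡b₂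
    ... | ()

  absurd : ⊥
  absurd =
    let β , full , not-full = root-matched⇒one-full root-colour≢P (inj₁ refl)
    in full-branch-forces-full-colour root-colour≢P full (not β) (only-root-colour-can-be-full (not β) not-full)

pc-partition-size≤3 : ∀ {G} → Tree₃ G → ∀ {k} → HasPCPartition G k → k ≤ 3
pc-partition-size≤3 𝒯 {k} (col , part) with k ≤? 3
... | yes k≤3 = k≤3
... | no k≰3  = ⊥-elim (NoLargePCPartition.absurd 𝒯 part (≰⇒> k≰3))

-- T(3) and a partition into three classes

module ByDecision {G : Graph} (adj? : ∀ u v → Dec (Adj G u v)) where

  V : Set
  V = Fin (n G)

  pendant? : ∀ l s → Dec (Pendant G l s)
  pendant? l s = all? λ w → adj? l w →-dec w ≟ s

  NeighboursAmong : V → V → V → V → Set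
  NeighboursAmong v x y z = ∀ w → Adj G v w → w ≡ x ⊎ w ≡ y ⊎ w ≡ z

  neighbours-among? : ∀ v x y z → Dec (NeighboursAmong v x y z)
  neighbours-among? v x y z = all? λ w → adj? v w →-dec (w ≟ x ⊎-dec w ≟ y ⊎-dec w ≟ z)

  CherryShape : (x s l₁ l₂ : V) → Set
  CherryShape x s l₁ l₂ =
    Pendant G l₁ s × Pendant G l₂ s × NeighboursAmong s x l₁ l₂ × l₁ ≢ l₂ × l₁ ≢ x × l₂ ≢ x

  cherry-shape? : ∀ x s l₁ l₂ → Dec (CherryShape x s l₁ l₂)
  cherry-shape? x s l₁ l₂ = pendant? l₁ s ×-dec pendant? l₂ s ×-dec neighbours-among? s x l₁ l₂
                            ×-dec ¬? (l₁ ≟ l₂) ×-dec ¬? (l₁ ≟ x) ×-dec ¬? (l₂ ≟ x)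

  cherry : ∀ {x} s l₁ l₂ → {True (cherry-shape? x s l₁ l₂)} → Cherry G x
  cherry s l₁ l₂ {shape} =
    let pendant₁ , pendant₂ , nbrs , l₁≢l₂ , l₁≢x , l₂≢x = toWitness shape in record
    { support        = s
    ; leaf           = λ b → if b then l₁ else l₂
    ; leaf-pendant   = λ { true → pendant₁ ; false → pendant₂ }
    ; support-nbrs   = λ w s~w → map₂ ∃-bool (nbrs w s~w)
    ; leaf-injective = bool-injective l₁≢l₂
    ; leaf≢parent    = λ { true → l₁≢x ; false → l₂≢x }
    }

  BranchShape : (r x : V) → Cherry G x → Cherry G x → Set
  BranchShape r x κ₁ κ₂ = NeighboursAmong x r s₁ s₂ × s₁ ≢ s₂ × s₁ ≢ r × s₂ ≢ r
    where
    s₁ = Cherry.support κ₁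
    s₂ = Cherry.support κ₂

  branch-shape? : ∀ r x κ₁ κ₂ → Dec (BranchShape r x κ₁ κ₂)
  branch-shape? r x κ₁ κ₂ = neighbours-among? x r s₁ s₂ ×-dec ¬? (s₁ ≟ s₂) ×-dec ¬? (s₁ ≟ r) ×-dec ¬? (s₂ ≟ r)
    where
    s₁ = Cherry.support κ₁
    s₂ = Cherry.support κ₂

  branch : ∀ {r} x (κ₁ κ₂ : Cherry G x) → {True (branch-shape? r x κ₁ κ₂)} → Branch G r
  branch x κ₁ κ₂ {shape} =
    let nbrs , s₁≢s₂ , s₁≢r , s₂≢r = toWitness shape in record
    { top               = x
    ; cherry            = λ b → if b then κ₁ else κ₂
    ; top-nbrs          = λ w x~w → map₂ ∃-bool (nbrs w x~w)
    ; support-injective = bool-injective s₁≢s₂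
    ; support≢root      = λ { true → s₁≢r ; false → s₂≢r }
    }

  TreeShape : V → V → V → Set
  TreeShape r t₁ t₂ = (∀ w → Adj G r w → w ≡ t₁ ⊎ w ≡ t₂) × t₁ ≢ t₂

  tree-shape? : ∀ r t₁ t₂ → Dec (TreeShape r t₁ t₂)
  tree-shape? r t₁ t₂ = (all? λ w → adj? r w →-dec (w ≟ t₁ ⊎-dec w ≟ t₂)) ×-dec ¬? (t₁ ≟ t₂)

  tree : ∀ r (β₁ β₂ : Branch G r) → {True (tree-shape? r (Branch.top β₁) (Branch.top β₂))} → Tree₃ G
  tree r β₁ β₂ {shape} =
    let nbrs , t₁≢t₂ = toWitness shape in record
    { root          = r
    ; branch        = λ β → if β then β₁ else β₂
    ; root-nbrs     = λ w r~w → ∃-bool (nbrs w r~w)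
    ; top-injective = bool-injective t₁≢t₂
    }

  dominating? : ∀ {S : VSet G} → Decidable S → Dec (Dominating G S)
  dominating? S? = all? λ v → S? v ⊎-dec any? λ u → adj? v u ×-dec S? u

  pairing? : ∀ {S : VSet G} → Decidable S → ∀ m → Dec (IsPairing G S m)
  pairing? S? m = all? λ v → S? v →-dec (S? (m v) ×-dec adj? v (m v) ×-dec m (m v) ≟ v)

  paired-dominating-via : ∀ {S : VSet G} (S? : Decidable S) m →
                          {True (dominating? S? ×-dec pairing? S? m)} → PairedDominating G S
  paired-dominating-via S? m {ok} = let dom , pairing = toWitness ok in dom , m , pairing

childOf? : ∀ i j → Dec (ChildOf i j)
childOf? i j = (j ℕ.≟ 2 ℕ.* i ℕ.+ 1) ⊎-dec (j ℕ.≟ 2 ℕ.* i ℕ.+ 2)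

adj? : ∀ h (u v : Fin (n (T h))) → Dec (Adj (T h) u v)
adj? h u v = childOf? (toℕ u) (toℕ v) ⊎-dec childOf? (toℕ v) (toℕ u)

open ByDecision (adj? 3)

T₃-tree : Tree₃ (T 3)
T₃-tree = tree (# 0)
  (branch (# 1) (cherry (# 3) (# 7) (# 8))  (cherry (# 4) (# 9)  (# 10)))
  (branch (# 2) (cherry (# 5) (# 11) (# 12)) (cherry (# 6) (# 13) (# 14)))

-- Class 0 holds the root and the four supports; classes 1 and 2 split the children of
-- the root and the two leaves of every support. In class 0 ∪ class i the root is paired
-- with its child in class i and every support with its leaf in class i.
colouring : Fin 15 → Fin 3
colouring = lookup (# 0 ∷ # 1 ∷ # 2 ∷ # 0 ∷ # 0 ∷ # 0 ∷ # 0 ∷ # 1 ∷ # 2 ∷ # 1 ∷ # 2 ∷ # 1 ∷ # 2 ∷ # 1 ∷ # 2 ∷ [])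

pair-with-class₁ pair-with-class₂ : Fin 15 → Fin 15
pair-with-class₁ = lookup (# 1 ∷ # 0 ∷ # 2 ∷ # 7 ∷ # 9 ∷ # 11 ∷ # 13 ∷ # 3 ∷ # 8 ∷ # 4 ∷ # 10 ∷ # 5 ∷ # 12 ∷ # 6 ∷ # 14 ∷ [])
pair-with-class₂ = lookup (# 2 ∷ # 1 ∷ # 0 ∷ # 8 ∷ # 10 ∷ # 12 ∷ # 14 ∷ # 7 ∷ # 3 ∷ # 9 ∷ # 4 ∷ # 11 ∷ # 5 ∷ # 13 ∷ # 6 ∷ [])

cls : Fin 3 → VSet (T 3)
cls = Class (T 3) colouring

union-of? : ∀ c d → Decidable (Union {T 3} (cls c) (cls d))
union-of? c d v = colouring v ≟ c ⊎-dec colouring v ≟ d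

class-not-pd : ∀ c → ¬ PairedDominating (T 3) (cls c)
class-not-pd zero (_ , m , pairing)
  with Tree₃.root-nbrs T₃-tree (m (# 0)) (Pairing.partner-adj {T 3} pairing refl)
... | β , r↦t = top-not-in-class₀ β (subst (λ v → colouring v ≡ # 0) r↦t (Pairing.partner-∈ {T 3} pairing refl))
  where
  top-not-in-class₀ : ∀ β → colouring (Branch.top (Tree₃.branch T₃-tree β)) ≢ # 0
  top-not-in-class₀ true ()
  top-not-in-class₀ false ()
class-not-pd (suc c) pd with Tree₃.supports-forced T₃-tree true true _ pd
... | ()

colouring-is-pc-partition : IsPCPartition (T 3) 3 colouring
colouring-is-pc-partition = nonempty , class-not-pd , coalition
  where
  nonempty : ∀ c → ∃ λ v → colouring v ≡ c
  nonempty = from-yes (all? λ c → any? λ v → colouring v ≟ c)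
  partner : Fin 3 → Fin 3
  partner zero = # 1
  partner (suc _) = # 0
  partner≢ : ∀ c → partner c ≢ c
  partner≢ zero ()
  partner≢ (suc zero) ()
  partner≢ (suc (suc zero)) ()
  union-pd : ∀ c → PairedDominating (T 3) (Union {T 3} (cls c) (cls (partner c)))
  union-pd zero             = paired-dominating-via (union-of? (# 0) (# 1)) pair-with-class₁
  union-pd (suc zero)       = paired-dominating-via (union-of? (# 1) (# 0)) pair-with-class₁
  union-pd (suc (suc zero)) = paired-dominating-via (union-of? (# 2) (# 0)) pair-with-class₂
  coalition : ∀ c → ∃ λ d → d ≢ c × PairedCoalition (T 3) (cls c) (cls d)
  coalition c = partner c , partner≢ c , (λ v v∈c v∈d → partner≢ c (trans (sym v∈d) v∈c))
              , class-not-pd c , class-not-pd (partner c) , union-pd c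

mainTheorem10 : PCNumber (T 3) 3
mainTheorem10 = inj₂ ((colouring , colouring-is-pc-partition) , λ k → pc-partition-size≤3 T₃-tree)
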